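{- Let $m\geq 2$, $p\geq 2$ and $0\leq i\leq p-1$, and let $M_i=\{i+rp : 0\leq r\leq m-1\}$ in the circulant graph $C(m,p)$. Then every permutation of the vertices of $C(m,p)$ that permutes the elements of $M_i$ arbitrarily and fixes every vertex outside $M_i$ is an automorphism of $C(m,p)$.
   Context: For integers $m\geq 1$, $p\geq 2$ with $n=mp\geq 3$, $C(m,p)$ is the graph with vertex set $\{0,1,\dots,n-1\}$ in which $i$ and $j$ are adjacent iff $j-i \bmod n$ belongs to $A=\{p-1+rp,\ p+1+rp : 0\leq r\leq m-1\}\subset\mathbb{Z}_n$. -}

module Defs where

open import Data.Nat using (ℕ; zero; suc; _+_; _*_; _∸_; _<_; _%_; NonZero)
open import Data.Fin using (Fin; toℕ)
open import Data.Product using (∃; _×_; _,_)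
open import Data.Sum using (_⊎_)
open import Relation.Binary.PropositionalEquality using (_≡_)
open import Function.Bundles using (_↔_; Inverse; _⇔_)

diffMod : (n : ℕ) .{{_ : NonZero n}} → ℕ → ℕ → ℕ
diffMod n i j = (j + (n ∸ i)) % n

InA : (m p : ℕ) .{{_ : NonZero (m * p)}} → ℕ → Set
InA m p d = ∃ λ r → r < m ×
  (d ≡ (p ∸ 1 + r * p) % (m * p) ⊎ d ≡ (p + 1 + r * p) % (m * p))

Adj : (m p : ℕ) .{{_ : NonZero (m * p)}} → Fin (m * p) → Fin (m * p) → Set
Adj m p u v = InA m p (diffMod (m * p) (toℕ u) (toℕ v))

-- M_i = { i + r p : 0 ≤ r ≤ m-1 } = vertices congruent to i mod p (for i < p).
InM : (m p : ℕ) .{{_ : NonZero p}} → ℕ → Fin (m * p) → Set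
InM m p i v = toℕ v % p ≡ i

IsAutomorphism : (m p : ℕ) .{{_ : NonZero (m * p)}} → Fin (m * p) ↔ Fin (m * p) → Set
IsAutomorphism m p σ = ∀ u v → (Adj m p u v ⇔ Adj m p (Inverse.to σ u) (Inverse.to σ v))

-- Whether u ~ v depends only on the residues of u and v modulo p: (v − u) mod n lies in A
-- exactly when it is ≡ ±1 (mod p), and p ∣ n. A permutation fixing every vertex outside
-- the residue class M_i maps M_i into itself, hence preserves all residues mod p, hence
-- preserves adjacency in both directions.
module Submission where

open import Defs
open import Data.Nat using (ℕ; zero; suc; _+_; _*_; _∸_; _%_; _/_; _≤_; _<_; s≤s; z≤n; NonZero; _≟_)
open import Data.Nat.Properties
open import Data.Nat.DivMod
open import Data.Nat.Divisibility using (_∣_; n∣m*n)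
open import Data.Fin using (Fin; toℕ)
open import Data.Fin.Properties using (toℕ<n)
open import Data.Product using (_,_)
open import Data.Sum using (_⊎_; inj₁; inj₂; map; map₂)
open import Relation.Nullary using (¬_; yes; no; contradiction)
open import Relation.Unary using (Pred; Decidable)
open import Relation.Binary.PropositionalEquality
open import Function.Bundles using (_↔_; Inverse; Injection; mk⇔)
open import Function.Properties.Inverse using (↔⇒↣)
open import Data.Nat.Solver using (module +-*-Solver)
open +-*-Solver

fixedOutside⇒preserves : ∀ {a ℓ} {A : Set a} (P : Pred A ℓ) → Decidable P →
  (σ : A ↔ A) → (∀ x → ¬ P x → Inverse.to σ x ≡ x) → ∀ {x} → P x → P (Inverse.to σ x)
fixedOutside⇒preserves P P? σ fixed {x} px with P? (Inverse.to σ x)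
... | yes pσx = pσx
... | no ¬pσx = contradiction (subst P (sym σx≡x) px) ¬pσx
  where
  σx≡x : Inverse.to σ x ≡ x
  σx≡x = Injection.injective (↔⇒↣ σ) (fixed _ ¬pσx)

module _ {p : ℕ} .{{_ : NonZero p}} where

  %-cong-+ : ∀ {a b c d} → a % p ≡ b % p → c % p ≡ d % p → (a + c) % p ≡ (b + d) % p
  %-cong-+ {a} {b} {c} {d} a≡b c≡d = begin
    (a + c) % p         ≡⟨ %-distribˡ-+ a c p ⟩
    (a % p + c % p) % p ≡⟨ cong₂ (λ x y → (x + y) % p) a≡b c≡d ⟩
    (b % p + d % p) % p ≡⟨ %-distribˡ-+ b d p ⟨
    (b + d) % p         ∎
    where open ≡-Reasoning

  -- Adding p ∸ c % p on both sides turns c into a multiple of p.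
  %-cancel-+ʳ : ∀ {a b} c → (a + c) % p ≡ (b + c) % p → a % p ≡ b % p
  %-cancel-+ʳ {a} {b} c a+c≡b+c = begin
    a % p                ≡⟨ remove a ⟨
    (a + c + k) % p      ≡⟨ %-cong-+ {a + c} {b + c} {k} a+c≡b+c refl ⟩
    (b + c + k) % p      ≡⟨ remove b ⟩
    b % p                ∎
    where
    open ≡-Reasoning
    k = p ∸ c % p
    c+k≡[1+c/p]*p : c + k ≡ suc (c / p) * p
    c+k≡[1+c/p]*p = begin
      c + k                   ≡⟨ cong (_+ k) (trans (m≡m%n+[m/n]*n c p) (+-comm (c % p) _)) ⟩
      c / p * p + c % p + k   ≡⟨ +-assoc (c / p * p) _ _ ⟩
      c / p * p + (c % p + k) ≡⟨ cong (c / p * p +_) (m+[n∸m]≡n (m%n≤n c p)) ⟩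
      c / p * p + p           ≡⟨ +-comm (c / p * p) p ⟩
      suc (c / p) * p         ∎
    remove : ∀ x → (x + c + k) % p ≡ x % p
    remove x = trans (cong (_% p) (trans (+-assoc x c k) (cong (x +_) c+k≡[1+c/p]*p)))
                     ([m+kn]%n≡m%n x (suc (c / p)) p)

  [b+[n∸a]]%p-cong : ∀ n → p ∣ n → ∀ {a a' b b'} → a ≤ n → a' ≤ n →
    a % p ≡ a' % p → b % p ≡ b' % p → (b + (n ∸ a)) % p ≡ (b' + (n ∸ a')) % p
  [b+[n∸a]]%p-cong n p∣n {a} {a'} {b} {b'} a≤n a'≤n a≡a' b≡b' =
    %-cancel-+ʳ a (begin
      (b + (n ∸ a) + a) % p    ≡⟨ cong (_% p) (add-back a≤n) ⟩
      (b + n) % p              ≡⟨ %-remove-+ʳ b p∣n ⟩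
      b % p                    ≡⟨ b≡b' ⟩
      b' % p                   ≡⟨ %-remove-+ʳ b' p∣n ⟨
      (b' + n) % p             ≡⟨ cong (_% p) (add-back a'≤n) ⟨
      (b' + (n ∸ a') + a') % p ≡⟨ %-cong-+ {b' + (n ∸ a')} refl (sym a≡a') ⟩
      (b' + (n ∸ a') + a) % p  ∎)
    where
    open ≡-Reasoning
    add-back : ∀ {x y} → x ≤ n → y + (n ∸ x) + x ≡ y + n
    add-back {x} {y} x≤n = trans (+-assoc y (n ∸ x) x) (cong (y +_) (m∸n+n≡m x≤n))

_≡±1[mod_] : ℕ → (p : ℕ) .{{_ : NonZero p}} → Set
d ≡±1[mod p ] = d % p ≡ p ∸ 1 ⊎ d % p ≡ 1

module _ (m p : ℕ) .{{_ : NonZero p}} .{{_ : NonZero (m * p)}} where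

  p∣m*p : p ∣ m * p
  p∣m*p = n∣m*n m

  InA⇒≡±1 : 2 ≤ p → ∀ {d} → InA m p d → d ≡±1[mod p ]
  InA⇒≡±1 2≤p {d} (r , _ , d≡) = map (residue (p ∸ 1) r p∸1<p) (residue 1 (suc r) 2≤p) d≡c+k*p
    where
    p∸1<p : p ∸ 1 < p
    p∸1<p = ∸-monoʳ-< {p} {1} {0} (s≤s z≤n) (≤-trans (s≤s z≤n) 2≤p)
    d≡c+k*p : d ≡ (p ∸ 1 + r * p) % (m * p) ⊎ d ≡ (1 + suc r * p) % (m * p)
    d≡c+k*p = map₂ (λ e → trans e (cong (_% (m * p))
            (solve 2 (λ p r → p :+ con 1 :+ r :* p := con 1 :+ (p :+ r :* p)) refl p r))) d≡
    residue : ∀ c k → c < p → d ≡ (c + k * p) % (m * p) → d % p ≡ c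
    residue c k c<p d≡c+kp = begin
      d % p                         ≡⟨ cong (_% p) d≡c+kp ⟩
      (c + k * p) % (m * p) % p     ≡⟨ m∣n⇒o%n%m≡o%m p (m * p) _ p∣m*p ⟩
      (c + k * p) % p               ≡⟨ [m+kn]%n≡m%n c k p ⟩
      c % p                         ≡⟨ m<n⇒m%n≡m c<p ⟩
      c                             ∎
      where open ≡-Reasoning

  ≡±1⇒InA : 1 ≤ m → ∀ {d} → d < m * p → d ≡±1[mod p ] → InA m p d
  ≡±1⇒InA 1≤m {d} d<n = fromQuotient (d / p) (m<n*o⇒m/o<n d<n) (m≡m%n+[m/n]*n d p)
    where
    open ≡-Reasoning
    reduce : ∀ {x} → x ≡ d → d ≡ x % (m * p)
    reduce x≡d = trans (sym (m<n⇒m%n≡m d<n)) (%-congˡ (sym x≡d))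
    fromQuotient : ∀ q → q < m → d ≡ d % p + q * p → d ≡±1[mod p ] → InA m p d
    fromQuotient q q<m d≡ (inj₁ d%p≡p∸1) =
      q , q<m , inj₁ (reduce (sym (trans d≡ (cong (_+ q * p) d%p≡p∸1))))
    fromQuotient (suc r) q<m d≡ (inj₂ d%p≡1) = r , <-trans (n<1+n r) q<m , inj₂ (reduce (begin
      p + 1 + r * p     ≡⟨ solve 2 (λ p r → p :+ con 1 :+ r :* p := con 1 :+ (con 1 :+ r) :* p) refl p r ⟩
      1 + suc r * p     ≡⟨ cong (_+ suc r * p) d%p≡1 ⟨
      d % p + suc r * p ≡⟨ d≡ ⟨
      d                 ∎))
    -- d = 1 is reached from the last element r = m − 1 of A, since p + 1 + (m − 1) p ≡ 1 (mod n).
    fromQuotient zero _ d≡ (inj₂ d%p≡1) = m ∸ 1 , ∸-monoʳ-< {m} {1} {0} (s≤s z≤n) 1≤m , inj₂ (begin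
      d                               ≡⟨ reduce (sym (trans d≡ (cong (_+ 0) d%p≡1))) ⟩
      1 % (m * p)                     ≡⟨ [m+n]%n≡m%n 1 (m * p) ⟨
      (1 + m * p) % (m * p)           ≡⟨ %-congˡ p+1+[m∸1]*p≡1+m*p ⟨
      (p + 1 + (m ∸ 1) * p) % (m * p) ∎)
      where
      p+1+[m∸1]*p≡1+m*p : p + 1 + (m ∸ 1) * p ≡ 1 + m * p
      p+1+[m∸1]*p≡1+m*p = begin
        p + 1 + (m ∸ 1) * p  ≡⟨ solve 2 (λ p k → p :+ con 1 :+ k :* p := con 1 :+ (con 1 :+ k) :* p) refl p (m ∸ 1) ⟩
        1 + suc (m ∸ 1) * p  ≡⟨ cong (λ k → 1 + k * p) (m+[n∸m]≡n 1≤m) ⟩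
        1 + m * p            ∎

  diffMod-cong-% : ∀ {a a' b b'} → a ≤ m * p → a' ≤ m * p → a % p ≡ a' % p → b % p ≡ b' % p →
    diffMod (m * p) a b % p ≡ diffMod (m * p) a' b' % p
  diffMod-cong-% {a} {a'} {b} {b'} a≤n a'≤n a≡a' b≡b' = begin
    (b + (m * p ∸ a)) % (m * p) % p   ≡⟨ m∣n⇒o%n%m≡o%m p (m * p) _ p∣m*p ⟩
    (b + (m * p ∸ a)) % p             ≡⟨ [b+[n∸a]]%p-cong (m * p) p∣m*p a≤n a'≤n a≡a' b≡b' ⟩
    (b' + (m * p ∸ a')) % p           ≡⟨ m∣n⇒o%n%m≡o%m p (m * p) _ p∣m*p ⟨
    (b' + (m * p ∸ a')) % (m * p) % p ∎
    where open ≡-Reasoning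

  Adj-resp-% : 1 ≤ m → 2 ≤ p → ∀ {u v u' v'} → toℕ u % p ≡ toℕ u' % p → toℕ v % p ≡ toℕ v' % p →
    Adj m p u v → Adj m p u' v'
  Adj-resp-% 1≤m 2≤p {u} {v} {u'} {v'} u≡u' v≡v' u~v =
    ≡±1⇒InA 1≤m (m%n<n _ (m * p)) (map (trans (sym d≡d')) (trans (sym d≡d')) (InA⇒≡±1 2≤p u~v))
    where
    d≡d' : diffMod (m * p) (toℕ u) (toℕ v) % p ≡ diffMod (m * p) (toℕ u') (toℕ v') % p
    d≡d' = diffMod-cong-% (<⇒≤ (toℕ<n u)) (<⇒≤ (toℕ<n u')) u≡u' v≡v'

mainTheorem5 : (m p i : ℕ) → 2 ≤ m → 2 ≤ p → i < p →
    .{{_ : NonZero p}} → .{{_ : NonZero (m * p)}} →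
    (σ : Fin (m * p) ↔ Fin (m * p)) →
    (∀ v → ¬ InM m p i v → Inverse.to σ v ≡ v) →
    IsAutomorphism m p σ
mainTheorem5 m p i 2≤m 2≤p _ σ fixed u v =
  mk⇔ (Adj-resp-% m p 1≤m 2≤p (sym (σ-preserves-% u)) (sym (σ-preserves-% v)))
      (Adj-resp-% m p 1≤m 2≤p (σ-preserves-% u) (σ-preserves-% v))
  where
  open Inverse σ using (to)
  1≤m : 1 ≤ m
  1≤m = ≤-trans (s≤s z≤n) 2≤m
  σ-preserves-% : ∀ w → toℕ (to w) % p ≡ toℕ w % p
  σ-preserves-% w with toℕ w % p ≟ i
  ... | yes w∈Mᵢ = trans (fixedOutside⇒preserves (InM m p i) (λ x → toℕ x % p ≟ i) σ fixed w∈Mᵢ) (sym w∈Mᵢ)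
  ... | no w∉Mᵢ = cong (λ x → toℕ x % p) (fixed w w∉Mᵢ)
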